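{- The operator $\Box^\bullet$ satisfies Löb's logic $\mathsf{GL}$ over $\mathsf{CHL}$: for all cyclic formulas $\phi,\psi$, (L1) if $\mathsf{CHL}\vdash\phi$ then $\mathsf{CHL}\vdash\Box^\bullet\phi$; (L2) $\mathsf{CHL}\vdash\Box^\bullet(\phi\to\psi)\to(\Box^\bullet\phi\to\Box^\bullet\psi)$; (L3) $\mathsf{CHL}\vdash\Box^\bullet\phi\to\Box^\bullet\Box^\bullet\phi$; (L4) $\mathsf{CHL}\vdash\Box^\bullet(\Box^\bullet\phi\to\phi)\to\Box^\bullet\phi$.
   Context: Labels: $\bot,\top$ and propositional variables (arity 0), $\neg,\Box$ (arity 1), $\wedge,\vee,\to$ (arity 2). A graph is $\langle V,r,S,\lambda\rangle$ with $V$ finite, root $r$, labelling $\lambda$, $S:V\to V^{*}$ ordered successors (length = arity of label); every vertex reachable from $r$. A (cyclic) formula is a graph in which every cycle (closed path of pairwise distinct vertices along successors) contains a $\Box$-labelled vertex. Bisimulation: $aRa'$ implies equal labels and $i$-th successors related; $\simeq$ = bisimilarity relating roots. $\phi$ modalised in $p$: every path from root to a $p$-labelled vertex contains a $\Box$-labelled vertex; then $\digamma p.\phi$ identifies the root with all $p$-labelled vertices (keeping the root's label). $\mathsf{CHL}$: least set of cyclic formulas containing all substitution instances of propositional tautologies, all $\Box(\phi\to\psi)\to(\Box\phi\to\Box\psi)$, all $\phi\leftrightarrow\psi$ with $\phi\simeq\psi$, closed under modus ponens, necessitation and Löb's rule (from $\vdash\Box\phi\to\phi$ infer $\vdash\phi$).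 $\Box^\bullet\phi:=\digamma p.\Box(\phi\wedge p)$ with $p$ not occurring in $\phi$. -}

module Defs where

open import Data.Nat using (ℕ; zero; suc; _+_)
open import Data.Fin using (Fin; zero; suc; _↑ˡ_; _↑ʳ_; splitAt)
open import Data.Bool using (Bool; true; false; not; _∧_; _∨_)
open import Data.Product using (Σ; _×_; _,_; proj₁; proj₂)
open import Data.Sum using (inj₁; inj₂)
open import Data.Vec using (Vec; []; _∷_; toList)
import Data.Vec as Vec
open import Data.Vec.Membership.Propositional using (_∈_)
open import Data.List using (List; _∷_; _∷ʳ_)
import Data.List as List
open import Data.Empty using () renaming (⊥ to Empty)
open import Data.List.Relation.Unary.Any using (Any)
open import Data.List.Relation.Unary.Linked using (Linked)
open import Data.List.Relation.Unary.Unique.Propositional using (Unique)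
open import Data.List.Relation.Binary.Pointwise using (Pointwise)
open import Relation.Binary.PropositionalEquality using (_≡_)

data BinOp : Set where
  and or imp : BinOp

data Label : Set where
  lbot ltop : Label
  lvar      : ℕ → Label
  lneg lbox : Label
  lbin      : BinOp → Label

arity : Label → ℕ
arity lbot     = 0
arity ltop     = 0
arity (lvar _) = 0
arity lneg     = 1
arity lbox     = 1
arity (lbin _) = 2

-- Graphs ⟨V, r, S, λ⟩ with V = Fin size; node v = (λ v , S v),
-- S v an ordered list of successors of length arity (λ v).

record Graph : Set where
  field
    size : ℕ
    root : Fin size
    node : Fin size → Σ Label (λ l → Vec (Fin size) (arity l))

  lab : Fin size → Label
  lab v = proj₁ (node v)

  succ' : (v : Fin size) → Vec (Fin size) (arity (lab v))
  succ' v = proj₂ (node v)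

  Edge : Fin size → Fin size → Set
  Edge u v = v ∈ succ' u

open Graph public

data Reachable (g : Graph) : Fin (size g) → Set where
  here : Reachable g (root g)
  step : ∀ {u v} → Reachable g u → Edge g u v → Reachable g v

IsCycle : (g : Graph) → List (Fin (size g)) → Set
IsCycle g List.[]  = Empty
IsCycle g (v ∷ vs) = Linked (Edge g) ((v ∷ vs) ∷ʳ v) × Unique (v ∷ vs)

IsFormula : Graph → Set
IsFormula g =
  (∀ v → Reachable g v) ×
  (∀ cs → IsCycle g cs → Any (λ w → lab g w ≡ lbox) cs)

IsBisimulation : (g h : Graph) → (Fin (size g) → Fin (size h) → Set) → Set
IsBisimulation g h R =
  ∀ a a' → R a a' →
    lab g a ≡ lab h a' × Pointwise R (toList (succ' g a)) (toList (succ' h a'))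

_≃_ : Graph → Graph → Set₁
g ≃ h = Σ (Fin (size g) → Fin (size h) → Set)
          (λ R → IsBisimulation g h R × R (root g) (root h))

private
  shift : ∀ {n} → Σ Label (λ l → Vec (Fin n) (arity l))
                → Σ Label (λ l → Vec (Fin (suc n)) (arity l))
  shift (l , s) = l , Vec.map suc s

  union : (g h : Graph) → Fin (size g + size h)
        → Σ Label (λ l → Vec (Fin (size g + size h)) (arity l))
  union g h v with splitAt (size g) v
  ... | inj₁ x = proj₁ (node g x) , Vec.map (_↑ˡ size h) (proj₂ (node g x))
  ... | inj₂ y = proj₁ (node h y) , Vec.map (size g ↑ʳ_) (proj₂ (node h y))

⊥G ⊤G : Graph
⊥G = record { size = 1 ; root = zero ; node = λ _ → lbot , [] }
⊤G = record { size = 1 ; root = zero ; node = λ _ → ltop , [] }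

varG : ℕ → Graph
varG p = record { size = 1 ; root = zero ; node = λ _ → lvar p , [] }

private
  unG : (l : Label) → (∀ {A : Set} → A → Vec A (arity l)) → Graph → Graph
  unG l mk g = record
    { size = suc (size g)
    ; root = zero
    ; node = λ { zero → l , mk (suc (root g)) ; (suc v) → shift (node g v) }
    }

¬G □G : Graph → Graph
¬G = unG lneg (λ x → x ∷ [])
□G = unG lbox (λ x → x ∷ [])

binG : BinOp → Graph → Graph → Graph
binG o g h = record
  { size = suc (size g + size h)
  ; root = zero
  ; node = λ { zero → lbin o , suc (root g ↑ˡ size h) ∷ suc (size g ↑ʳ root h) ∷ []
             ; (suc v) → shift (union g h v) }
  }

_∧G_ _∨G_ _⇒G_ _⇔G_ : Graph → Graph → Graph
g ∧G h = binG and g h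
g ∨G h = binG or g h
g ⇒G h = binG imp g h
g ⇔G h = (g ⇒G h) ∧G (h ⇒G g)

infixr 6 _∧G_
infixr 5 _∨G_
infixr 4 _⇒G_
infix 3 _⇔G_

-- □•φ := ϝp.□(φ ∧ p) (p not in φ): the graph □(φ ∧ p) with the p-vertex
-- identified with the root.  Vertex 0 = root (□), vertex 1 = the ∧-vertex,
-- whose successors are the root of (a copy of) φ and the root.
□•G : Graph → Graph
□•G g = record
  { size = suc (suc (size g))
  ; root = zero
  ; node = λ { zero → lbox , suc zero ∷ []
             ; (suc zero) → lbin and , suc (suc (root g)) ∷ zero ∷ []
             ; (suc (suc v)) → shift (shift (node g v)) }
  }

data PForm (k : ℕ) : Set where
  pv        : Fin k → PForm k
  p⊥ p⊤     : PForm k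
  p¬        : PForm k → PForm k
  p∧ p∨ p⇒  : PForm k → PForm k → PForm k

eval : ∀ {k} → (Fin k → Bool) → PForm k → Bool
eval ρ (pv i)   = ρ i
eval ρ p⊥       = false
eval ρ p⊤       = true
eval ρ (p¬ a)   = not (eval ρ a)
eval ρ (p∧ a b) = eval ρ a ∧ eval ρ b
eval ρ (p∨ a b) = eval ρ a ∨ eval ρ b
eval ρ (p⇒ a b) = not (eval ρ a) ∨ eval ρ b

Tautology : ∀ {k} → PForm k → Set
Tautology τ = ∀ ρ → eval ρ τ ≡ true

inst : ∀ {k} → (Fin k → Graph) → PForm k → Graph
inst σ (pv i)   = σ i
inst σ p⊥       = ⊥G
inst σ p⊤       = ⊤G
inst σ (p¬ a)   = ¬G (inst σ a)
inst σ (p∧ a b) = inst σ a ∧G inst σ b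
inst σ (p∨ a b) = inst σ a ∨G inst σ b
inst σ (p⇒ a b) = inst σ a ⇒G inst σ b

data CHL : Graph → Set₁ where
  taut : ∀ {k} (τ : PForm k) → Tautology τ →
         (σ : Fin k → Graph) → (∀ i → IsFormula (σ i)) → CHL (inst σ τ)
  axK  : ∀ φ ψ → IsFormula φ → IsFormula ψ →
         CHL (□G (φ ⇒G ψ) ⇒G (□G φ ⇒G □G ψ))
  bisim : ∀ φ ψ → IsFormula φ → IsFormula ψ → φ ≃ ψ → CHL (φ ⇔G ψ)
  mp   : ∀ {φ ψ} → CHL φ → CHL (φ ⇒G ψ) → CHL ψ
  nec  : ∀ {φ} → CHL φ → CHL (□G φ)
  löb  : ∀ {φ} → CHL (□G φ ⇒G φ) → CHL φ

module Submission where

-- □•φ is bisimilar to its one-step unfolding □(φ ∧ □•φ), so CHL proves □•φ ↔ □(φ ∧ □•φ).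
-- Each GL principle for □• is then proved by Löb's rule for □: assume the goal under □,
-- unfold the □•-hypotheses, use K for □ once, and fold back.

open import Defs
open import Data.Product using (_×_; Σ; ∃; _,_; proj₁; proj₂)
open import Data.Nat using (ℕ; zero; suc; _+_)
open import Data.Fin using (Fin; zero; suc; _↑ˡ_; _↑ʳ_; splitAt)
open import Data.Fin.Properties using (splitAt-↑ˡ; splitAt-↑ʳ; splitAt⁻¹-↑ˡ; splitAt⁻¹-↑ʳ; ↑ˡ-injective; ↑ʳ-injective; suc-injective)
open import Data.Sum using (_⊎_; inj₁; inj₂)
open import Data.Vec using (Vec; []; _∷_; toList)
import Data.Vec as Vec
open import Data.Vec.Properties using (map-∘)
open import Data.Vec.Functional using (Vector) renaming (_∷_ to _∷ᵛ_)
import Data.Vec.Relation.Unary.Any as VecAny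
open import Data.Vec.Relation.Unary.Any.Properties using () renaming (map⁻ to VecAny-map⁻)
open import Data.Vec.Membership.Propositional using () renaming (_∈_ to _∈ᵥ_)
open import Data.Vec.Membership.Propositional.Properties using (∈-map⁺; fromAny)
open import Data.List using ([]; _∷_; _∷ʳ_)
import Data.List as List
open import Data.List.Properties using (map-++)
open import Data.List.Membership.Propositional using (_∈_; lose)
open import Data.List.Relation.Unary.Any using (Any; here; there)
import Data.List.Relation.Unary.Any as Any
open import Data.List.Relation.Unary.Any.Properties using () renaming (map⁺ to Any-map⁺)
open import Data.List.Relation.Unary.All using (All; []; _∷_)
open import Data.List.Relation.Unary.All.Properties using (∷ʳ⁻)
open import Data.List.Relation.Binary.Pointwise using (Pointwise; []; _∷_)
open import Data.List.Relation.Unary.Linked using (Linked; []; [-]; _∷_)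
import Data.List.Relation.Unary.Linked as Linked
import Data.List.Relation.Unary.Linked.Properties as Linked
import Data.List.Relation.Unary.Unique.Propositional.Properties as Unique
open import Data.Bool using (Bool; true; false; not)
import Data.Bool as Bool
open import Data.Bool.Properties using (∧-conicalˡ; ∧-conicalʳ)
open import Data.Empty using (⊥; ⊥-elim)
open import Function using (_∘_)
open import Relation.Binary.PropositionalEquality

∈-map⁻ : ∀ {A B : Set} {m} (f : A → B) {w} {s : Vec A m} →
         w ∈ᵥ Vec.map f s → ∃ λ b → b ∈ᵥ s × w ≡ f b
∈-map⁻ f = fromAny ∘ VecAny-map⁻

Linked-∷ʳ-predecessor : ∀ {A : Set} {R : A → A → Set} x xs {y} →
  Linked R ((x ∷ xs) ∷ʳ y) → ∃ λ u → u ∈ x ∷ xs × R u y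
Linked-∷ʳ-predecessor x []        (r ∷ _) = x , here refl , r
Linked-∷ʳ-predecessor x (x′ ∷ xs) (_ ∷ l) with Linked-∷ʳ-predecessor x′ xs l
... | u , u∈ , r = u , there u∈ , r

Linked-closed : ∀ {A : Set} {R : A → A → Set} {P : A → Set} →
  (∀ {a b} → P a → R a b → P b) → ∀ {x} xs → P x → Linked R (x ∷ xs) → All P (x ∷ xs)
Linked-closed closed []       px [-]     = px ∷ []
Linked-closed closed (_ ∷ xs) px (r ∷ l) = px ∷ Linked-closed closed xs (closed px r) l

All-image⇒map : ∀ {A B : Set} (f : A → B) {ys} →
  All (λ y → ∃ λ x → y ≡ f x) ys → ∃ λ xs → ys ≡ List.map f xs
All-image⇒map f []                 = [] , refl
All-image⇒map f ((x , refl) ∷ all) with All-image⇒map f all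
... | xs , refl = x ∷ xs , refl

↑-split : ∀ m n (u : Fin (m + n)) → (∃ λ x → x ↑ˡ n ≡ u) ⊎ (∃ λ y → m ↑ʳ y ≡ u)
↑-split m n u with splitAt m u in eq
... | inj₁ x = inj₁ (x , splitAt⁻¹-↑ˡ eq)
... | inj₂ y = inj₂ (y , splitAt⁻¹-↑ʳ eq)

Boxed : (g : Graph) → Fin (size g) → Set
Boxed g w = lab g w ≡ lbox

BoxedCycles : Graph → Set
BoxedCycles g = ∀ cs → IsCycle g cs → Any (Boxed g) cs

cycle-predecessor : ∀ g v vs → IsCycle g (v ∷ vs) → ∃ λ u → u ∈ v ∷ vs × Edge g u v
cycle-predecessor g v vs (l , _) = Linked-∷ʳ-predecessor v vs l

record Embedding (g h : Graph) : Set where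
  field
    ι           : Fin (size g) → Fin (size h)
    ι-injective : ∀ {a b} → ι a ≡ ι b → a ≡ b
    node-ι      : ∀ a → node h (ι a) ≡ (lab g a , Vec.map ι (succ' g a))

  lab-ι : ∀ a → lab h (ι a) ≡ lab g a
  lab-ι a = cong proj₁ (node-ι a)

  edge-ι⁺ : ∀ {a b} → Edge g a b → Edge h (ι a) (ι b)
  edge-ι⁺ {a} e = subst (λ n → _ ∈ᵥ proj₂ n) (sym (node-ι a)) (∈-map⁺ ι e)

  edge-ι⁻ : ∀ {a w} → Edge h (ι a) w → ∃ λ b → Edge g a b × w ≡ ι b
  edge-ι⁻ {a} e = ∈-map⁻ ι (subst (λ n → _ ∈ᵥ proj₂ n) (node-ι a) e)

  edge-reflect : ∀ {a b} → Edge h (ι a) (ι b) → Edge g a b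
  edge-reflect e with edge-ι⁻ e
  ... | _ , e′ , eq rewrite ι-injective eq = e′

  InImage : Fin (size h) → Set
  InImage w = ∃ λ a → w ≡ ι a

  image-closed : ∀ {v w} → InImage v → Edge h v w → InImage w
  image-closed (a , refl) e with edge-ι⁻ e
  ... | b , _ , eq = b , eq

  reachable-ι : Reachable h (ι (root g)) → ∀ {v} → Reachable g v → Reachable h (ι v)
  reachable-ι r here       = r
  reachable-ι r (step p e) = step (reachable-ι r p) (edge-ι⁺ e)

  cycle-ι⁻ : ∀ ds → IsCycle h (List.map ι ds) → IsCycle g ds
  cycle-ι⁻ (d ∷ ds) (l , u) =
    Linked.map edge-reflect (Linked.map⁻ (subst (Linked (Edge h)) (sym (map-++ ι (d ∷ ds) (d ∷ []))) l)) ,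
    Unique.map⁻ u

  cycle-in-image : BoxedCycles g → ∀ cs → IsCycle h cs → All InImage cs → Any (Boxed h) cs
  cycle-in-image boxed cs cy inImage with All-image⇒map ι inImage
  ... | ds , refl = Any-map⁺ (Any.map (trans (lab-ι _)) (boxed ds (cycle-ι⁻ ds cy)))

  cycle-through-ι : BoxedCycles g → ∀ a vs → IsCycle h (ι a ∷ vs) → Any (Boxed h) (ι a ∷ vs)
  cycle-through-ι boxed a vs cy@(l , _) =
    cycle-in-image boxed _ cy (proj₁ (∷ʳ⁻ (Linked-closed image-closed (vs ∷ʳ ι a) (a , refl) l)))

open Embedding

module _ (g : Graph) where

  □G-embedding : Embedding g (□G g)
  □G-embedding = record { ι = suc ; ι-injective = suc-injective ; node-ι = λ _ → refl }

  □G-isFormula : IsFormula g → IsFormula (□G g)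
  □G-isFormula (reach , boxed) = reach′ , boxed′
    where
    reach′ : ∀ v → Reachable (□G g) v
    reach′ zero    = here
    reach′ (suc v) = reachable-ι □G-embedding (step here (VecAny.here refl)) (reach v)
    boxed′ : BoxedCycles (□G g)
    boxed′ (zero  ∷ _)  _  = here refl
    boxed′ (suc a ∷ vs) cy = cycle-through-ι □G-embedding boxed a vs cy

  □•G-embedding : Embedding g (□•G g)
  □•G-embedding = record
    { ι = λ a → suc (suc a)
    ; ι-injective = λ eq → suc-injective (suc-injective eq)
    ; node-ι = λ a → cong (lab g a ,_) (sym (map-∘ suc suc (succ' g a)))
    }

  □•G-predecessor-of-∧ : ∀ u → Edge (□•G g) u (suc zero) → u ≡ zero
  □•G-predecessor-of-∧ zero          _ = refl
  □•G-predecessor-of-∧ (suc zero)    (VecAny.here ())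
  □•G-predecessor-of-∧ (suc zero)    (VecAny.there (VecAny.here ()))
  □•G-predecessor-of-∧ (suc (suc a)) e with edge-ι⁻ □•G-embedding e
  ... | _ , _ , ()

  □•G-isFormula : IsFormula g → IsFormula (□•G g)
  □•G-isFormula (reach , boxed) = reach′ , boxed′
    where
    reach′ : ∀ v → Reachable (□•G g) v
    reach′ zero          = here
    reach′ (suc zero)    = step here (VecAny.here refl)
    reach′ (suc (suc v)) =
      reachable-ι □•G-embedding (step (reach′ (suc zero)) (VecAny.here refl)) (reach v)
    boxed′ : BoxedCycles (□•G g)
    boxed′ (zero ∷ _) _ = here refl
    boxed′ (suc zero ∷ vs) cy with cycle-predecessor (□•G g) _ vs cy
    ... | u , u∈ , e = lose u∈ (cong (lab (□•G g)) (□•G-predecessor-of-∧ u e))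
    boxed′ (suc (suc a) ∷ vs) cy = cycle-through-ι □•G-embedding boxed a vs cy

module _ (o : BinOp) (g h : Graph) where

  private
    B = binG o g h

  binG-left : Embedding g B
  binG-left = record
    { ι = λ x → suc (x ↑ˡ size h)
    ; ι-injective = λ {a} {b} → ↑ˡ-injective (size h) a b ∘ suc-injective
    ; node-ι = node-left
    }
    where
    node-left : ∀ x →
      node B (suc (x ↑ˡ size h)) ≡ (lab g x , Vec.map (λ x → suc (x ↑ˡ size h)) (succ' g x))
    node-left x rewrite splitAt-↑ˡ (size g) x (size h) =
      cong (lab g x ,_) (sym (map-∘ suc (_↑ˡ size h) (succ' g x)))

  binG-right : Embedding h B
  binG-right = record
    { ι = λ y → suc (size g ↑ʳ y)
    ; ι-injective = λ {a} {b} → ↑ʳ-injective (size g) a b ∘ suc-injective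
    ; node-ι = node-right
    }
    where
    node-right : ∀ y →
      node B (suc (size g ↑ʳ y)) ≡ (lab h y , Vec.map (λ y → suc (size g ↑ʳ y)) (succ' h y))
    node-right y rewrite splitAt-↑ʳ (size g) (size h) y =
      cong (lab h y ,_) (sym (map-∘ suc (size g ↑ʳ_) (succ' h y)))

  binG-root-no-predecessor : ∀ u → Edge B u zero → ⊥
  binG-root-no-predecessor zero  (VecAny.here ())
  binG-root-no-predecessor zero  (VecAny.there (VecAny.here ()))
  binG-root-no-predecessor (suc v) e with ∈-map⁻ suc e
  ... | _ , _ , ()

  binG-isFormula : IsFormula g → IsFormula h → IsFormula B
  binG-isFormula (reach-g , boxed-g) (reach-h , boxed-h) = reach , boxed
    where
    reach : ∀ v → Reachable B v
    reach zero = here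
    reach (suc u) with ↑-split (size g) (size h) u
    ... | inj₁ (x , refl) = reachable-ι binG-left (step here (VecAny.here refl)) (reach-g x)
    ... | inj₂ (y , refl) =
      reachable-ι binG-right (step here (VecAny.there (VecAny.here refl))) (reach-h y)
    boxed : BoxedCycles B
    boxed (zero ∷ vs) cy with cycle-predecessor B zero vs cy
    ... | u , _ , e = ⊥-elim (binG-root-no-predecessor u e)
    boxed (suc u ∷ vs) cy with ↑-split (size g) (size h) u
    ... | inj₁ (x , refl) = cycle-through-ι binG-left boxed-g x vs cy
    ... | inj₂ (y , refl) = cycle-through-ι binG-right boxed-h y vs cy

module _ (φ : Graph) where

  private
    G = □•G φ
    H = □G (φ ∧G □•G φ)

  -- Sends the copy of □•φ inside the unfolding back onto □•φ itself.
  collapse : Fin (size H) → Fin (size G)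
  collapse zero          = zero
  collapse (suc zero)    = suc zero
  collapse (suc (suc u)) with splitAt (size φ) u
  ... | inj₁ x = suc (suc x)
  ... | inj₂ y = y

  collapse-φ : ∀ x → collapse (suc (suc (x ↑ˡ size G))) ≡ suc (suc x)
  collapse-φ x rewrite splitAt-↑ˡ (size φ) x (size G) = refl

  collapse-□•φ : ∀ y → collapse (suc (suc (size φ ↑ʳ y))) ≡ y
  collapse-□•φ y rewrite splitAt-↑ʳ (size φ) (size G) y = refl

  Collapses : Fin (size G) → Fin (size H) → Set
  Collapses a b = collapse b ≡ a

  collapse-φ-successors : ∀ {m} (s : Vec (Fin (size φ)) m) →
    Pointwise Collapses (toList (Vec.map suc (Vec.map suc s)))
                        (toList (Vec.map suc (Vec.map suc (Vec.map (_↑ˡ size G) s))))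
  collapse-φ-successors []      = []
  collapse-φ-successors (x ∷ s) = collapse-φ x ∷ collapse-φ-successors s

  collapse-□•φ-successors : ∀ {m} (s : Vec (Fin (size G)) m) →
    Pointwise Collapses (toList s) (toList (Vec.map suc (Vec.map suc (Vec.map (size φ ↑ʳ_) s))))
  collapse-□•φ-successors []      = []
  collapse-□•φ-successors (x ∷ s) = collapse-□•φ x ∷ collapse-□•φ-successors s

  collapses-bisimulation : IsBisimulation G H Collapses
  collapses-bisimulation _ zero          refl = refl , refl ∷ []
  collapses-bisimulation _ (suc zero)    refl = refl , collapse-φ (root φ) ∷ collapse-□•φ zero ∷ []
  collapses-bisimulation _ (suc (suc u)) refl with splitAt (size φ) u
  ... | inj₁ x = refl , collapse-φ-successors (succ' φ x)
  ... | inj₂ y = refl , collapse-□•φ-successors (succ' G y)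

  □•G-unfolding : □•G φ ≃ □G (φ ∧G □•G φ)
  □•G-unfolding = Collapses , collapses-bisimulation , refl

Valuation : ℕ → Set
Valuation = Vector Bool

Extensional : ∀ {k} → (Valuation k → Bool) → Set
Extensional f = ∀ {ρ σ} → ρ ≗ σ → f ρ ≡ f σ

allValuations : ∀ k → (Valuation k → Bool) → Bool
allValuations zero    f = f (λ ())
allValuations (suc k) f =
  allValuations k (λ ρ → f (true ∷ᵛ ρ)) Bool.∧ allValuations k (λ ρ → f (false ∷ᵛ ρ))

-- Valuations are functions, so ρ and ρ zero ∷ᵛ (ρ ∘ suc) agree only pointwise; hence Extensional.
allValuations-sound : ∀ k f → Extensional f → allValuations k f ≡ true → ∀ ρ → f ρ ≡ true
allValuations-sound zero    f ext h ρ = trans (ext (λ ())) h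
allValuations-sound (suc k) f ext h ρ =
  trans (ext (λ { zero → refl ; (suc i) → refl }))
        (allValuations-sound k (λ σ → f (ρ zero ∷ᵛ σ)) (λ eq → ext (λ { zero → refl ; (suc i) → eq i }))
          (branch (ρ zero)) (ρ ∘ suc))
  where
  branch : ∀ b → allValuations k (λ σ → f (b ∷ᵛ σ)) ≡ true
  branch true  = ∧-conicalˡ _ _ h
  branch false = ∧-conicalʳ _ _ h

eval-extensional : ∀ {k} (τ : PForm k) → Extensional (λ ρ → eval ρ τ)
eval-extensional (pv i)   eq = eq i
eval-extensional p⊥       eq = refl
eval-extensional p⊤       eq = refl
eval-extensional (p¬ a)   eq = cong not (eval-extensional a eq)
eval-extensional (p∧ a b) eq = cong₂ Bool._∧_ (eval-extensional a eq) (eval-extensional b eq)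
eval-extensional (p∨ a b) eq = cong₂ Bool._∨_ (eval-extensional a eq) (eval-extensional b eq)
eval-extensional (p⇒ a b) eq = cong₂ (λ x y → not x Bool.∨ y) (eval-extensional a eq) (eval-extensional b eq)

infixr 4 _⇒_
infixr 6 _∧_
infix  8 □_ □•_

-- Formula expressions over cyclic formulas; being a data type, they let the derived rules
-- below infer their formula arguments, which graph-valued connectives would not.
data Formula : Set where
  ⌜_⌝     : Σ Graph IsFormula → Formula
  _⇒_ _∧_ : Formula → Formula → Formula
  □_ □•_  : Formula → Formula

graph : Formula → Graph
graph ⌜ φ ⌝    = proj₁ φ
graph (A ⇒ B) = graph A ⇒G graph B
graph (A ∧ B) = graph A ∧G graph B
graph (□ A)   = □G (graph A)
graph (□• A)  = □•G (graph A)

graph-isFormula : ∀ A → IsFormula (graph A)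
graph-isFormula ⌜ φ ⌝    = proj₂ φ
graph-isFormula (A ⇒ B) = binG-isFormula imp _ _ (graph-isFormula A) (graph-isFormula B)
graph-isFormula (A ∧ B) = binG-isFormula and _ _ (graph-isFormula A) (graph-isFormula B)
graph-isFormula (□ A)   = □G-isFormula _ (graph-isFormula A)
graph-isFormula (□• A)  = □•G-isFormula _ (graph-isFormula A)

infix 3 ⊢_

record ⊢_ (A : Formula) : Set₁ where
  constructor ⊢⟨_⟩
  field derivation : CHL (graph A)

open ⊢_

⊢-mp : ∀ {A B} → ⊢ A → ⊢ A ⇒ B → ⊢ B
⊢-mp ⊢⟨ a ⟩ ⊢⟨ a⇒b ⟩ = ⊢⟨ mp a a⇒b ⟩

byTruthTable : ∀ {k} (τ : PForm k) → allValuations k (λ ρ → eval ρ τ) ≡ true →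
  (As : Vec Formula k) → CHL (inst (λ i → graph (Vec.lookup As i)) τ)
byTruthTable τ h As =
  taut τ (allValuations-sound _ _ (eval-extensional τ) h) _ (λ i → graph-isFormula (Vec.lookup As i))

infixr 4 _⇒ₚ_
infixr 6 _∧ₚ_

_⇒ₚ_ _∧ₚ_ : ∀ {k} → PForm k → PForm k → PForm k
_⇒ₚ_ = p⇒
_∧ₚ_ = p∧

pattern p₀ = pv zero
pattern p₁ = pv (suc zero)
pattern p₂ = pv (suc (suc zero))
pattern p₃ = pv (suc (suc (suc zero)))
pattern p₄ = pv (suc (suc (suc (suc zero))))
pattern p₅ = pv (suc (suc (suc (suc (suc zero)))))

⊢-K : ∀ {A B} → ⊢ □ (A ⇒ B) ⇒ □ A ⇒ □ B
⊢-K {A} {B} = ⊢⟨ axK _ _ (graph-isFormula A) (graph-isFormula B) ⟩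

⊢-löb : ∀ {A} → ⊢ □ A ⇒ A → ⊢ A
⊢-löb ⊢⟨ h ⟩ = ⊢⟨ löb h ⟩

□-mono : ∀ {A B} → ⊢ A ⇒ B → ⊢ □ A ⇒ □ B
□-mono ⊢⟨ h ⟩ = ⊢-mp ⊢⟨ nec h ⟩ ⊢-K

⇒-trans : ∀ {A B C} → ⊢ A ⇒ B → ⊢ B ⇒ C → ⊢ A ⇒ C
⇒-trans {A} {B} {C} h₁ h₂ =
  ⊢-mp h₂ (⊢-mp h₁ ⊢⟨ byTruthTable ((p₀ ⇒ₚ p₁) ⇒ₚ (p₁ ⇒ₚ p₂) ⇒ₚ p₀ ⇒ₚ p₂) refl (A ∷ B ∷ C ∷ []) ⟩)

∧-curry : ∀ {A B C} → ⊢ A ∧ B ⇒ C → ⊢ A ⇒ B ⇒ C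
∧-curry {A} {B} {C} h = ⊢-mp h ⊢⟨ byTruthTable ((p₀ ∧ₚ p₁ ⇒ₚ p₂) ⇒ₚ p₀ ⇒ₚ p₁ ⇒ₚ p₂) refl (A ∷ B ∷ C ∷ []) ⟩

∧-mono : ∀ {A B C D} → ⊢ A ⇒ B → ⊢ C ⇒ D → ⊢ A ∧ C ⇒ B ∧ D
∧-mono {A} {B} {C} {D} h₁ h₂ = ⊢-mp h₂ (⊢-mp h₁
  ⊢⟨ byTruthTable ((p₀ ⇒ₚ p₁) ⇒ₚ (p₂ ⇒ₚ p₃) ⇒ₚ p₀ ∧ₚ p₂ ⇒ₚ p₁ ∧ₚ p₃) refl (A ∷ B ∷ C ∷ D ∷ []) ⟩)

□-∧-intro : ∀ {A B} → ⊢ □ A ∧ □ B ⇒ □ (A ∧ B)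
□-∧-intro {A} {B} = ⊢-mp (⊢-K {B} {A ∧ B}) (⊢-mp (□-mono pair)
  ⊢⟨ byTruthTable ((p₀ ⇒ₚ p₁) ⇒ₚ (p₁ ⇒ₚ p₂ ⇒ₚ p₃) ⇒ₚ p₀ ∧ₚ p₂ ⇒ₚ p₃) refl
                  (□ A ∷ □ (B ⇒ A ∧ B) ∷ □ B ∷ □ (A ∧ B) ∷ []) ⟩)
  where
  pair : ⊢ A ⇒ B ⇒ A ∧ B
  pair = ⊢⟨ byTruthTable (p₀ ⇒ₚ p₁ ⇒ₚ p₀ ∧ₚ p₁) refl (A ∷ B ∷ []) ⟩

bisimilar-implies : ∀ {A B} → graph A ≃ graph B → ⊢ A ⇒ B × ⊢ B ⇒ A
bisimilar-implies {A} {B} A≃B =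
  ⊢-mp iff ⊢⟨ byTruthTable ((p₀ ⇒ₚ p₁) ∧ₚ (p₁ ⇒ₚ p₀) ⇒ₚ p₀ ⇒ₚ p₁) refl (A ∷ B ∷ []) ⟩ ,
  ⊢-mp iff ⊢⟨ byTruthTable ((p₀ ⇒ₚ p₁) ∧ₚ (p₁ ⇒ₚ p₀) ⇒ₚ p₁ ⇒ₚ p₀) refl (A ∷ B ∷ []) ⟩
  where
  iff : ⊢ (A ⇒ B) ∧ (B ⇒ A)
  iff = ⊢⟨ bisim _ _ (graph-isFormula A) (graph-isFormula B) A≃B ⟩

□•-unfold : ∀ A → ⊢ □• A ⇒ □ (A ∧ □• A)
□•-unfold A = proj₁ (bisimilar-implies (□•G-unfolding (graph A)))

□•-fold : ∀ A → ⊢ □ (A ∧ □• A) ⇒ □• A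
□•-fold A = proj₂ (bisimilar-implies (□•G-unfolding (graph A)))

-- Under the assumption □(X ⇒ Z) the first premise yields □P ⇒ □Q, hence X ⇒ □P ⇒ □Q ⇒ Z;
-- Löb's rule then discharges the assumption.
löb-induction : ∀ {X Z P Q} → ⊢ (X ⇒ Z) ⇒ (P ⇒ Q) → ⊢ X ⇒ □ P → ⊢ □ Q ⇒ Z → ⊢ X ⇒ Z
löb-induction {X} {Z} {P} {Q} reduce X⇒□P □Q⇒Z =
  ⊢-löb (⊢-mp □Q⇒Z (⊢-mp X⇒□P (⊢-mp (⊢-K {P} {Q}) (⊢-mp (□-mono reduce)
    ⊢⟨ byTruthTable ((p₀ ⇒ₚ p₁) ⇒ₚ (p₁ ⇒ₚ p₂ ⇒ₚ p₃) ⇒ₚ (p₄ ⇒ₚ p₂) ⇒ₚ (p₃ ⇒ₚ p₅) ⇒ₚ p₀ ⇒ₚ p₄ ⇒ₚ p₅) refl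
                    (□ (X ⇒ Z) ∷ □ (P ⇒ Q) ∷ □ P ∷ □ Q ∷ X ∷ Z ∷ []) ⟩))))

□•-necessitation : ∀ {A} → ⊢ A → ⊢ □• A
□•-necessitation {A} ⊢A = ⊢-löb (⇒-trans (□-mono pair) (□•-fold A))
  where
  pair : ⊢ □• A ⇒ A ∧ □• A
  pair = ⊢-mp ⊢A ⊢⟨ byTruthTable (p₀ ⇒ₚ p₁ ⇒ₚ p₀ ∧ₚ p₁) refl (A ∷ □• A ∷ []) ⟩

□•-distrib-⇒ : ∀ {A B} → ⊢ □• (A ⇒ B) ⇒ □• A ⇒ □• B
□•-distrib-⇒ {A} {B} = ∧-curry (löb-induction
  ⊢⟨ byTruthTable ((p₂ ∧ₚ p₃ ⇒ₚ p₄) ⇒ₚ ((p₀ ⇒ₚ p₁) ∧ₚ p₂) ∧ₚ (p₀ ∧ₚ p₃) ⇒ₚ p₁ ∧ₚ p₄) refl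
                  (A ∷ B ∷ □• (A ⇒ B) ∷ □• A ∷ □• B ∷ []) ⟩
  (⇒-trans (∧-mono (□•-unfold (A ⇒ B)) (□•-unfold A)) □-∧-intro)
  (□•-fold B))

□•-transitive : ∀ {A} → ⊢ □• A ⇒ □• □• A
□•-transitive {A} = löb-induction
  ⊢⟨ byTruthTable ((p₁ ⇒ₚ p₂) ⇒ₚ p₀ ∧ₚ p₁ ⇒ₚ p₁ ∧ₚ p₂) refl (A ∷ □• A ∷ □• □• A ∷ []) ⟩
  (□•-unfold A)
  (□•-fold (□• A))

□•-löb : ∀ {A} → ⊢ □• (□• A ⇒ A) ⇒ □• A
□•-löb {A} = löb-induction
  ⊢⟨ byTruthTable ((p₂ ⇒ₚ p₁) ⇒ₚ (p₁ ⇒ₚ p₀) ∧ₚ p₂ ⇒ₚ p₀ ∧ₚ p₁) refl (A ∷ □• A ∷ □• (□• A ⇒ A) ∷ []) ⟩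
  (□•-unfold (□• A ⇒ A))
  (□•-fold A)

theorem3p4 : (φ ψ : Graph) → IsFormula φ → IsFormula ψ →
    (CHL φ → CHL (□•G φ)) ×
    CHL (□•G (φ ⇒G ψ) ⇒G (□•G φ ⇒G □•G ψ)) ×
    CHL (□•G φ ⇒G □•G (□•G φ)) ×
    CHL (□•G (□•G φ ⇒G φ) ⇒G □•G φ)
theorem3p4 φ ψ φ-formula ψ-formula =
  (λ ⊢φ → derivation (□•-necessitation {A} ⊢⟨ ⊢φ ⟩)) ,
  derivation (□•-distrib-⇒ {A} {B}) ,
  derivation (□•-transitive {A}) ,
  derivation (□•-löb {A})
  where
  A B : Formula
  A = ⌜ φ , φ-formula ⌝
  B = ⌜ ψ , ψ-formula ⌝
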